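{- Let $G\leq\mathrm{Sym}(V)$ be a transitive permutation group, and let $H\leq S_n$ be a transitive permutation group having the EKR-property. Then $\rho(G\wr H)=\rho(G)$.
   Context: The wreath product $G\wr H$ is the set of permutations $((g_1,\ldots,g_n),h)$ ($g_i\in G$, $h\in H$) of $V\times\{1,\ldots,n\}$ acting by $(a,i)\mapsto (g_i(a),h(i))$. For a permutation group $K$ acting on $X$, a subset $I\subseteq K$ is intersecting if for all $g,h\in I$ there is $x\in X$ with $g(x)=h(x)$. For transitive $K$, $\rho(K)=\max|I|/|K_x|$ over intersecting sets $I$, $K_x$ a point stabilizer. $K$ has the EKR-property if the maximum size of an intersecting set equals the order of the largest point stabilizer. -}

module Defs where

open import Data.Nat using (ℕ; zero; suc; _*_; _≤_)
open import Data.Fin using (Fin; combine; remQuot)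
open import Data.Fin.Properties as FinP using ()
open import Data.Vec using (Vec; lookup; tabulate)
open import Data.Vec.Properties using (≡-dec)
open import Data.List using (List; []; _∷_; length; filter; concatMap; map; allFin; deduplicate)
open import Data.List.Membership.Propositional using (_∈_)
open import Data.List.Relation.Unary.All using (All)
open import Data.List.Relation.Unary.Unique.Propositional using (Unique)
open import Data.Product using (Σ; ∃; _×_; _,_; proj₁; proj₂)
open import Relation.Binary.PropositionalEquality using (_≡_)
open import Relation.Binary.Definitions using (DecidableEquality)
open import Function.Definitions using (Injective)

-- A map Fin m → Fin m, stored as its table of values (so equality is decidable).
Perm : ℕ → Set
Perm m = Vec (Fin m) m

_≟ₚ_ : ∀ {m} → DecidableEquality (Perm m)
_≟ₚ_ = ≡-dec FinP._≟_

IsPerm : ∀ {m} → Perm m → Set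
IsPerm g = Injective _≡_ _≡_ (lookup g)

idPerm : ∀ {m} → Perm m
idPerm = tabulate (λ x → x)

_∘ₚ_ : ∀ {m} → Perm m → Perm m → Perm m
g ∘ₚ h = tabulate (λ x → lookup g (lookup h x))

-- A permutation group on V = Fin m: a duplicate-free finite list of
-- permutations containing the identity and closed under composition
-- (for finite sets this is exactly a subgroup of Sym(V)).
record PermGroup (m : ℕ) : Set where
  field
    elems  : List (Perm m)
    unique : Unique elems
    perms  : All IsPerm elems
    hasId  : idPerm ∈ elems
    closed : ∀ {g h} → g ∈ elems → h ∈ elems → (g ∘ₚ h) ∈ elems
open PermGroup public

Transitive : ∀ {m} → List (Perm m) → Set
Transitive {m} K = ∀ (x y : Fin m) → ∃ λ g → g ∈ K × lookup g x ≡ y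

stabSize : ∀ {m} → List (Perm m) → Fin m → ℕ
stabSize K x = length (filter (λ g → lookup g x FinP.≟ x) K)

Intersecting : ∀ {m} → List (Perm m) → List (Perm m) → Set
Intersecting {m} K I =
  Unique I × All (_∈ K) I ×
  (∀ {g h} → g ∈ I → h ∈ I → ∃ λ (x : Fin m) → lookup g x ≡ lookup h x)

IsMaxIntersecting : ∀ {m} → List (Perm m) → ℕ → Set
IsMaxIntersecting K k =
  (∃ λ I → Intersecting K I × length I ≡ k) ×
  (∀ I → Intersecting K I → length I ≤ k)

EKR : ∀ {m} → List (Perm m) → Set
EKR {m} K = ∀ k → IsMaxIntersecting K k →
  (∀ (x : Fin m) → stabSize K x ≤ k) × (∃ λ (x : Fin m) → stabSize K x ≡ k)

tuples : ∀ {A : Set} (n : ℕ) → List A → List (Vec A n)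
tuples zero    L = Data.Vec.[] ∷ []
tuples (suc n) L = concatMap (λ a → map (a Data.Vec.∷_) (tuples n L)) L

-- The point (a , i) ∈ V × {1..n} is encoded as combine i a : Fin (n * m).
-- ((g_1,…,g_n), h) acts by (a , i) ↦ (g_i(a) , h(i)).
wreathElem : ∀ {m n} → Vec (Perm m) n → Perm n → Perm (n * m)
wreathElem {m} {n} gs h = tabulate λ z →
  let i = proj₁ (remQuot {n} m z)
      a = proj₂ (remQuot {n} m z)
  in combine (lookup h i) (lookup (lookup gs i) a)

wreath : ∀ {m n} → PermGroup m → PermGroup n → List (Perm (n * m))
wreath {m} {n} G H = deduplicate _≟ₚ_
  (concatMap (λ h → map (λ gs → wreathElem gs h) (tuples n (elems G))) (elems H))

-- Write y = (a , i). Lifting an intersecting set I of G to {((gⱼ), h) : h i ≡ i, gᵢ ∈ I} gives an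
-- intersecting set of G ≀ H with |Hᵢ|·|I|·|G|ⁿ⁻¹ elements. Conversely, in an intersecting set of
-- G ≀ H the tops h form an intersecting set of H, hence at most kH = |Hᵢ| of them (EKR and
-- transitivity); over a fixed top and a fixed key (g₀⁻¹gⱼ)ⱼ₌₁…ₙ₋₁ the coordinates g₀ form an
-- intersecting set of G, and there are |G|ⁿ⁻¹ keys. So the maximum is |Hᵢ|·kG·|G|ⁿ⁻¹, while
-- |(G ≀ H)_y| = |Hᵢ|·|G_a|·|G|ⁿ⁻¹ and |G_a| = |G_x|. The maximum kH exists only classically, which
-- suffices because the goal is a decidable equation of naturals.
module Submission where

open import Defs
open import Data.Empty using (⊥-elim)
open import Data.Fin using (Fin; zero; suc; combine; quotient; remainder)
import Data.Fin.Properties as Fin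
open import Data.List using (List; []; _∷_; [_]; length; filter; map; concatMap; _++_; cartesianProductWith; deduplicate)
open import Data.List.Properties using (length-++; length-map; filter-notAll)
open import Data.List.Membership.Propositional using (_∈_)
open import Data.List.Membership.Propositional.Properties
  using ( ∈-filter⁺; ∈-filter⁻; ∈-map⁺; ∈-map⁻; ∈-deduplicate⁺; ∈-deduplicate⁻
        ; ∈-cartesianProductWith⁺; ∈-cartesianProductWith⁻)
open import Data.List.Relation.Binary.Subset.Propositional using (_⊆_)
import Data.List.Relation.Binary.Sublist.Propositional.Properties as Sublist
open import Data.List.Relation.Unary.All using (All; [])
import Data.List.Relation.Unary.All as All
import Data.List.Relation.Unary.All.Properties as All
open import Data.List.Relation.Unary.Any using (Any; here; there)
import Data.List.Relation.Unary.Any as Any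
open import Data.List.Relation.Unary.Unique.Propositional using (Unique; []; _∷_)
open import Data.List.Relation.Unary.Unique.DecPropositional.Properties using (deduplicate-!)
import Data.List.Relation.Unary.Unique.Propositional.Properties as Unique
open import Data.Nat using (ℕ; zero; suc; _+_; _*_; _^_; _≤_; _<_; _≟_; z≤n)
open import Data.Nat.Properties
open import Data.Nat.Tactic.RingSolver using (solve-∀)
open import Algebra.Properties.CommutativeSemigroup *-commutativeSemigroup using (x∙yz≈y∙xz)
open import Data.Product using (∃; ∃₂; _×_; _,_; proj₁; proj₂)
import Data.Product as Product
open import Data.Vec using (Vec; []; _∷_; lookup; tabulate; replicate; _[_]≔_)
open import Data.Vec.Properties
  using ( ≡-dec; ∷-injective; lookup-replicate; lookup∘update; lookup∘update′
        ; lookup∘tabulate; tabulate∘lookup; tabulate-cong)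
open import Function using (_∘_)
open import Relation.Binary.Definitions using (DecidableEquality)
open import Relation.Binary.PropositionalEquality
  using (_≡_; _≢_; refl; sym; trans; cong; cong₂; subst; module ≡-Reasoning)
open import Relation.Nullary using (¬_; ¬?; yes; no; ¬¬-excluded-middle)
open import Relation.Nullary.Decidable using (decidable-stable)
open import Relation.Unary using (Pred; Decidable)
open import Level using (0ℓ)

module _ {A : Set} {P : Pred A 0ℓ} (P? : Decidable P) where

  length-filter+length-filter-¬ : ∀ xs →
    length (filter P? xs) + length (filter (¬? ∘ P?) xs) ≡ length xs
  length-filter+length-filter-¬ [] = refl
  length-filter+length-filter-¬ (x ∷ xs) with P? x
  ... | yes _ = cong suc (length-filter+length-filter-¬ xs)
  ... | no  _ = trans (+-suc _ _) (cong suc (length-filter+length-filter-¬ xs))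

module _ {A : Set} (_≟_ : DecidableEquality A) where

  unique-⊆⇒length≤ : ∀ {xs ys : List A} → Unique xs → xs ⊆ ys → length xs ≤ length ys
  unique-⊆⇒length≤ {[]} _ _ = z≤n
  unique-⊆⇒length≤ {x ∷ xs} {ys} (x∉xs ∷ xs!) xs⊆ys = begin-strict
    length xs                             ≤⟨ unique-⊆⇒length≤ xs! xs⊆ys-x ⟩
    length (filter (¬? ∘ (x ≟_)) ys)      <⟨ filter-notAll (¬? ∘ (x ≟_)) ys x∈ys ⟩
    length ys                             ∎
    where
    open ≤-Reasoning
    xs⊆ys-x : xs ⊆ filter (¬? ∘ (x ≟_)) ys
    xs⊆ys-x z∈xs = ∈-filter⁺ (¬? ∘ (x ≟_)) (xs⊆ys (there z∈xs)) (All.lookup x∉xs z∈xs)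
    x∈ys : Any (λ y → ¬ ¬ x ≡ y) ys
    x∈ys = Any.map (λ x≡y x≢y → x≢y x≡y) (xs⊆ys (here refl))

  fibre : {B : Set} → (B → A) → List B → A → List B
  fibre f xs a = filter (λ w → f w ≟ a) xs

  length≤fibres : ∀ {B : Set} (f : B → A) {b} (ps : List A) (xs : List B) →
    (∀ {w} → w ∈ xs → f w ∈ ps) → (∀ p → length (fibre f xs p) ≤ b) →
    length xs ≤ length ps * b
  length≤fibres f []       []      _    _         = z≤n
  length≤fibres f []       (x ∷ _) f∈ps _         with () ← f∈ps (here refl)
  length≤fibres f {b} (p ∷ ps) xs f∈ps fibre≤b = begin
    length xs                              ≡⟨ length-filter+length-filter-¬ (λ w → f w ≟ p) xs ⟨
    length (fibre f xs p) + length rest    ≤⟨ +-mono-≤ (fibre≤b p) (length≤fibres f ps rest f∈ps′ fibre′≤b) ⟩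
    b + length ps * b                      ∎
    where
    open ≤-Reasoning
    rest = filter (¬? ∘ (λ w → f w ≟ p)) xs
    f∈ps′ : ∀ {w} → w ∈ rest → f w ∈ ps
    f∈ps′ w∈rest with ∈-filter⁻ (¬? ∘ (λ w → f w ≟ p)) {xs = xs} w∈rest
    ... | w∈xs , fw≢p with f∈ps w∈xs
    ... | here fw≡p = ⊥-elim (fw≢p fw≡p)
    ... | there fw∈ps = fw∈ps
    fibre′≤b : ∀ q → length (fibre f rest q) ≤ b
    fibre′≤b q = ≤-trans
      (Sublist.length-mono-≤ (Sublist.filter⁺ _ _ (λ { refl fw≡q → fw≡q }) (Sublist.filter-⊆ _ xs)))
      (fibre≤b q)

map⁺-injectiveOn : ∀ {A B : Set} (f : A → B) {xs : List A} →
  (∀ {x y} → x ∈ xs → y ∈ xs → f x ≡ f y → x ≡ y) → Unique xs → Unique (map f xs)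
map⁺-injectiveOn f inj []             = []
map⁺-injectiveOn f inj (x∉xs ∷ xs!) =
  All.map⁺ (All.tabulate λ y∈xs fx≡fy → All.lookup x∉xs y∈xs (inj (here refl) (there y∈xs) fx≡fy))
  ∷ map⁺-injectiveOn f (λ x∈ y∈ → inj (there x∈) (there y∈)) xs!

module _ {A B C : Set} (f : A → B → C) where

  concatMap≡cartesianProductWith : ∀ xs ys →
    concatMap (λ x → map (f x) ys) xs ≡ cartesianProductWith f xs ys
  concatMap≡cartesianProductWith []       ys = refl
  concatMap≡cartesianProductWith (x ∷ xs) ys = cong (map (f x) ys ++_) (concatMap≡cartesianProductWith xs ys)

  length-cartesianProductWith : ∀ xs ys → length (cartesianProductWith f xs ys) ≡ length xs * length ys
  length-cartesianProductWith []       ys = refl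
  length-cartesianProductWith (x ∷ xs) ys = begin
    length (map (f x) ys ++ cartesianProductWith f xs ys)        ≡⟨ length-++ (map (f x) ys) ⟩
    length (map (f x) ys) + length (cartesianProductWith f xs ys)
      ≡⟨ cong₂ _+_ (length-map (f x) ys) (length-cartesianProductWith xs ys) ⟩
    length ys + length xs * length ys                             ∎
    where open ≡-Reasoning

module _ {A : Set} where

  tuplesOf : ∀ {k} → (Fin k → List A) → List (Vec A k)
  tuplesOf {zero}  Ls = [ [] ]
  tuplesOf {suc k} Ls = cartesianProductWith _∷_ (Ls zero) (tuplesOf (Ls ∘ suc))

  tuples≡tuplesOf : ∀ k (L : List A) → tuples k L ≡ tuplesOf (λ _ → L)
  tuples≡tuplesOf zero    L = refl
  tuples≡tuplesOf (suc k) L = trans (concatMap≡cartesianProductWith _∷_ L (tuples k L))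
                                    (cong (cartesianProductWith _∷_ L) (tuples≡tuplesOf k L))

  ∈-tuplesOf⁺ : ∀ {k} {Ls : Fin k → List A} {xs : Vec A k} →
    (∀ j → lookup xs j ∈ Ls j) → xs ∈ tuplesOf Ls
  ∈-tuplesOf⁺ {xs = []}     _   = here refl
  ∈-tuplesOf⁺ {xs = x ∷ xs} xs∈ = ∈-cartesianProductWith⁺ _∷_ (xs∈ zero) (∈-tuplesOf⁺ (xs∈ ∘ suc))

  ∈-tuplesOf⁻ : ∀ {k} (Ls : Fin k → List A) {xs : Vec A k} →
    xs ∈ tuplesOf Ls → ∀ j → lookup xs j ∈ Ls j
  ∈-tuplesOf⁻ {suc k} Ls xs∈ j
    with _ , _ , x∈ , xs′∈ , refl ← ∈-cartesianProductWith⁻ _∷_ (Ls zero) (tuplesOf (Ls ∘ suc)) xs∈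
       | j
  ... | zero  = x∈
  ... | suc j = ∈-tuplesOf⁻ (Ls ∘ suc) xs′∈ j

  tuplesOf-unique : ∀ {k} {Ls : Fin k → List A} → (∀ j → Unique (Ls j)) → Unique (tuplesOf Ls)
  tuplesOf-unique {zero}  _  = [] ∷ []
  tuplesOf-unique {suc k} Ls! = Unique.cartesianProductWith⁺ _∷_ ∷-injective (Ls! zero) (tuplesOf-unique (Ls! ∘ suc))

  length-tuplesOf-const : ∀ {k ℓ} (Ls : Fin k → List A) → (∀ j → length (Ls j) ≡ ℓ) →
    length (tuplesOf Ls) ≡ ℓ ^ k
  length-tuplesOf-const {zero}  Ls _  = refl
  length-tuplesOf-const {suc k} Ls ∣Ls∣≡ℓ = trans (length-cartesianProductWith _∷_ (Ls zero) (tuplesOf (Ls ∘ suc)))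
    (cong₂ _*_ (∣Ls∣≡ℓ zero) (length-tuplesOf-const (Ls ∘ suc) (∣Ls∣≡ℓ ∘ suc)))

  length-tuplesOf-except : ∀ {k ℓ} (Ls : Fin (suc k) → List A) i → (∀ j → j ≢ i → length (Ls j) ≡ ℓ) →
    length (tuplesOf Ls) ≡ length (Ls i) * ℓ ^ k
  length-tuplesOf-except Ls zero ∣Ls∣≡ℓ = trans (length-cartesianProductWith _∷_ (Ls zero) (tuplesOf (Ls ∘ suc)))
    (cong (length (Ls zero) *_) (length-tuplesOf-const (Ls ∘ suc) (λ j → ∣Ls∣≡ℓ (suc j) λ ())))
  length-tuplesOf-except {suc k} {ℓ} Ls (suc i) ∣Ls∣≡ℓ = begin
    length (cartesianProductWith _∷_ (Ls zero) (tuplesOf (Ls ∘ suc)))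
      ≡⟨ length-cartesianProductWith _∷_ (Ls zero) (tuplesOf (Ls ∘ suc)) ⟩
    length (Ls zero) * length (tuplesOf (Ls ∘ suc))
      ≡⟨ cong₂ _*_ (∣Ls∣≡ℓ zero λ ()) (length-tuplesOf-except (Ls ∘ suc) i ∣Ls∘suc∣≡ℓ) ⟩
    ℓ * (length (Ls (suc i)) * ℓ ^ k)
      ≡⟨ x∙yz≈y∙xz ℓ (length (Ls (suc i))) (ℓ ^ k) ⟩
    length (Ls (suc i)) * ℓ ^ suc k
      ∎
    where
    open ≡-Reasoning
    ∣Ls∘suc∣≡ℓ : ∀ j → j ≢ i → length (Ls (suc j)) ≡ ℓ
    ∣Ls∘suc∣≡ℓ j j≢i = ∣Ls∣≡ℓ (suc j) (j≢i ∘ Fin.suc-injective)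

  lookup∘update-replicate′ : ∀ {k} {i j : Fin k} {L : List A} (Q : List A) → j ≢ i →
    lookup (replicate k L [ i ]≔ Q) j ≡ L
  lookup∘update-replicate′ {k} {j = j} {L} Q j≢i = trans (lookup∘update′ j≢i (replicate k L) Q) (lookup-replicate j L)

  length-tuples : ∀ k (L : List A) → length (tuples k L) ≡ length L ^ k
  length-tuples k L = trans (cong length (tuples≡tuplesOf k L)) (length-tuplesOf-const {k} (λ _ → L) (λ _ → refl))

  ∈-tuples⁺ : ∀ {k L} {xs : Vec A k} → (∀ j → lookup xs j ∈ L) → xs ∈ tuples k L
  ∈-tuples⁺ {k} {L} xs∈L = subst (_ ∈_) (sym (tuples≡tuplesOf k L)) (∈-tuplesOf⁺ xs∈L)

  tuplesAt : ∀ {k} → Fin k → List A → List A → List (Vec A k)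
  tuplesAt {k} i Q L = tuplesOf (lookup (replicate k L [ i ]≔ Q))

  module _ {k} (i : Fin k) (Q L : List A) where

    private
      Ls = lookup (replicate k L [ i ]≔ Q)

      Ls-at : Ls i ≡ Q
      Ls-at = lookup∘update i (replicate k L) Q

      Ls-off : ∀ {j} → j ≢ i → Ls j ≡ L
      Ls-off = lookup∘update-replicate′ Q

    ∈-tuplesAt⁺ : ∀ {xs} → (∀ j → lookup xs j ∈ L) → lookup xs i ∈ Q → xs ∈ tuplesAt i Q L
    ∈-tuplesAt⁺ {xs} xs∈L xsᵢ∈Q = ∈-tuplesOf⁺ entry
      where
      entry : ∀ j → lookup xs j ∈ Ls j
      entry j with j Fin.≟ i
      ... | yes refl = subst (lookup xs i ∈_) (sym Ls-at) xsᵢ∈Q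
      ... | no j≢i   = subst (lookup xs j ∈_) (sym (Ls-off j≢i)) (xs∈L j)

    ∈-tuplesAt⁻ : Q ⊆ L → ∀ {xs} → xs ∈ tuplesAt i Q L → lookup xs i ∈ Q × (∀ j → lookup xs j ∈ L)
    ∈-tuplesAt⁻ Q⊆L {xs} xs∈ = subst (lookup xs i ∈_) Ls-at (∈-tuplesOf⁻ Ls xs∈ i) , entry
      where
      entry : ∀ j → lookup xs j ∈ L
      entry j with j Fin.≟ i
      ... | yes refl = Q⊆L (subst (lookup xs i ∈_) Ls-at (∈-tuplesOf⁻ Ls xs∈ i))
      ... | no j≢i   = subst (lookup xs j ∈_) (Ls-off j≢i) (∈-tuplesOf⁻ Ls xs∈ j)

    tuplesAt-unique : Unique Q → Unique L → Unique (tuplesAt i Q L)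
    tuplesAt-unique Q! L! = tuplesOf-unique entry
      where
      entry : ∀ j → Unique (Ls j)
      entry j with j Fin.≟ i
      ... | yes refl = subst Unique (sym Ls-at) Q!
      ... | no j≢i   = subst Unique (sym (Ls-off j≢i)) L!

  length-tuplesAt : ∀ {k} (i : Fin (suc k)) (Q L : List A) → length (tuplesAt i Q L) ≡ length Q * length L ^ k
  length-tuplesAt {k} i Q L = trans
    (length-tuplesOf-except (lookup (replicate (suc k) L [ i ]≔ Q)) i
      (λ j j≢i → cong length (lookup∘update-replicate′ Q j≢i)))
    (cong (λ Q′ → length Q′ * length L ^ k) (lookup∘update i (replicate _ L) Q))

lookup-ext : ∀ {A : Set} {k} {xs ys : Vec A k} → (∀ j → lookup xs j ≡ lookup ys j) → xs ≡ ys
lookup-ext {xs = xs} {ys} eq = trans (sym (tabulate∘lookup xs)) (trans (tabulate-cong eq) (tabulate∘lookup ys))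

module _ {m : ℕ} where

  lookup-∘ₚ : ∀ (g h : Perm m) x → lookup (g ∘ₚ h) x ≡ lookup g (lookup h x)
  lookup-∘ₚ g h = lookup∘tabulate _

  lookup-idPerm : ∀ (x : Fin m) → lookup idPerm x ≡ x
  lookup-idPerm = lookup∘tabulate _

  stabilizer : List (Perm m) → Fin m → List (Perm m)
  stabilizer K x = filter (λ g → lookup g x Fin.≟ x) K

  ∈-stabilizer⁺ : ∀ {K g x} → g ∈ K → lookup g x ≡ x → g ∈ stabilizer K x
  ∈-stabilizer⁺ {x = x} = ∈-filter⁺ (λ g → lookup g x Fin.≟ x)

  stabilizer-unique : ∀ {K} x → Unique K → Unique (stabilizer K x)
  stabilizer-unique x = Unique.filter⁺ (λ g → lookup g x Fin.≟ x)

  ∈-stabilizer⁻ : ∀ K {g x} → g ∈ stabilizer K x → g ∈ K × lookup g x ≡ x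
  ∈-stabilizer⁻ K {x = x} = ∈-filter⁻ (λ g → lookup g x Fin.≟ x) {xs = K}

  rightInverseIn : List (Perm m) → Perm m → Perm m
  rightInverseIn []       g = idPerm
  rightInverseIn (h ∷ hs) g with (g ∘ₚ h) ≟ₚ idPerm
  ... | yes _ = h
  ... | no  _ = rightInverseIn hs g

  rightInverseIn-sound : ∀ {g} hs → Any (λ h → g ∘ₚ h ≡ idPerm) hs →
    rightInverseIn hs g ∈ hs × g ∘ₚ rightInverseIn hs g ≡ idPerm
  rightInverseIn-sound {g} (h ∷ hs) inv∈ with (g ∘ₚ h) ≟ₚ idPerm | inv∈
  ... | yes gh≡id | _          = here refl , gh≡id
  ... | no  gh≢id | here gh≡id = ⊥-elim (gh≢id gh≡id)
  ... | no  _     | there inv∈ = Product.map₁ there (rightInverseIn-sound hs inv∈)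

module _ {m} (G : PermGroup m) where

  ∈⇒injective : ∀ {g} → g ∈ elems G → ∀ {x y} → lookup g x ≡ lookup g y → x ≡ y
  ∈⇒injective = All.lookup (perms G)

  ∘ₚ-cancelˡ : ∀ {g} → g ∈ elems G → ∀ {h h′} → g ∘ₚ h ≡ g ∘ₚ h′ → h ≡ h′
  ∘ₚ-cancelˡ {g} g∈G {h} {h′} gh≡gh′ = lookup-ext λ x → ∈⇒injective g∈G (begin
    lookup g (lookup h x)   ≡⟨ lookup-∘ₚ g h x ⟨
    lookup (g ∘ₚ h) x       ≡⟨ cong (λ f → lookup f x) gh≡gh′ ⟩
    lookup (g ∘ₚ h′) x      ≡⟨ lookup-∘ₚ g h′ x ⟩
    lookup g (lookup h′ x)  ∎)
    where open ≡-Reasoning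

  -- Left multiplication by g maps G injectively into itself, so by counting it must hit idPerm.
  ∃-rightInverse : ∀ {g} → g ∈ elems G → Any (λ h → g ∘ₚ h ≡ idPerm) (elems G)
  ∃-rightInverse {g} g∈G with Any.any? (λ h → (g ∘ₚ h) ≟ₚ idPerm) (elems G)
  ... | yes inv∈ = inv∈
  ... | no  inv∉ = ⊥-elim (<-irrefl (length-map (g ∘ₚ_) (elems G)) (unique-⊆⇒length≤ _≟ₚ_ id∷gG! id∷gG⊆G))
    where
    id∉gG : All (idPerm ≢_) (map (g ∘ₚ_) (elems G))
    id∉gG = All.map⁺ (All.¬Any⇒All¬ _ (λ gh≡id → inv∉ (Any.map sym gh≡id)))
    id∷gG! : Unique (idPerm ∷ map (g ∘ₚ_) (elems G))
    id∷gG! = id∉gG ∷ Unique.map⁺ (∘ₚ-cancelˡ g∈G) (unique G)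
    id∷gG⊆G : idPerm ∷ map (g ∘ₚ_) (elems G) ⊆ elems G
    id∷gG⊆G (here refl) = hasId G
    id∷gG⊆G (there gh∈) with _ , h∈G , refl ← ∈-map⁻ (g ∘ₚ_) gh∈ = closed G g∈G h∈G

  inverse : Perm m → Perm m
  inverse = rightInverseIn (elems G)

  inverse-∈ : ∀ {g} → g ∈ elems G → inverse g ∈ elems G
  inverse-∈ {g} g∈G = proj₁ (rightInverseIn-sound {g = g} (elems G) (∃-rightInverse g∈G))

  inverse-∘ₚʳ : ∀ {g} → g ∈ elems G → g ∘ₚ inverse g ≡ idPerm
  inverse-∘ₚʳ {g} g∈G = proj₂ (rightInverseIn-sound {g = g} (elems G) (∃-rightInverse g∈G))

  inverse-lookupʳ : ∀ {g} → g ∈ elems G → ∀ x → lookup g (lookup (inverse g) x) ≡ x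
  inverse-lookupʳ {g} g∈G x = begin
    lookup g (lookup (inverse g) x)  ≡⟨ lookup-∘ₚ g (inverse g) x ⟨
    lookup (g ∘ₚ inverse g) x        ≡⟨ cong (λ f → lookup f x) (inverse-∘ₚʳ g∈G) ⟩
    lookup idPerm x                  ≡⟨ lookup-idPerm x ⟩
    x                                ∎
    where open ≡-Reasoning

  inverse-lookupˡ : ∀ {g} → g ∈ elems G → ∀ x → lookup (inverse g) (lookup g x) ≡ x
  inverse-lookupˡ {g} g∈G x = ∈⇒injective g∈G (inverse-lookupʳ g∈G (lookup g x))

  conjugate : Perm m → Perm m → Perm m
  conjugate g s = g ∘ₚ (s ∘ₚ inverse g)

  lookup-conjugate : ∀ g s z → lookup (conjugate g s) z ≡ lookup g (lookup s (lookup (inverse g) z))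
  lookup-conjugate g s z = trans (lookup-∘ₚ g (s ∘ₚ inverse g) z) (cong (lookup g) (lookup-∘ₚ s (inverse g) z))

  conjugate-injective : ∀ {g} → g ∈ elems G → ∀ {s s′} → conjugate g s ≡ conjugate g s′ → s ≡ s′
  conjugate-injective {g} g∈G {s} {s′} gsg⁻¹≡gs′g⁻¹ = lookup-ext λ u → ∈⇒injective g∈G (begin
    lookup g (lookup s u)                                   ≡⟨ cong (lookup g ∘ lookup s) (inverse-lookupˡ g∈G u) ⟨
    lookup g (lookup s (lookup (inverse g) (lookup g u)))   ≡⟨ lookup-conjugate g s (lookup g u) ⟨
    lookup (conjugate g s) (lookup g u)                     ≡⟨ cong (λ f → lookup f (lookup g u)) gsg⁻¹≡gs′g⁻¹ ⟩
    lookup (conjugate g s′) (lookup g u)                    ≡⟨ lookup-conjugate g s′ (lookup g u) ⟩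
    lookup g (lookup s′ (lookup (inverse g) (lookup g u)))  ≡⟨ cong (lookup g ∘ lookup s′) (inverse-lookupˡ g∈G u) ⟩
    lookup g (lookup s′ u)                                  ∎)
    where open ≡-Reasoning

  conjugate-stabilizer : ∀ {g x x′ s} → g ∈ elems G → lookup g x ≡ x′ →
    s ∈ stabilizer (elems G) x → conjugate g s ∈ stabilizer (elems G) x′
  conjugate-stabilizer {g} {x} {x′} {s} g∈G gx≡x′ s∈Gₓ
    with s∈G , sx≡x ← ∈-stabilizer⁻ (elems G) s∈Gₓ =
    ∈-stabilizer⁺ (closed G g∈G (closed G s∈G (inverse-∈ g∈G))) (begin
      lookup (conjugate g s) x′                    ≡⟨ lookup-conjugate g s x′ ⟩
      lookup g (lookup s (lookup (inverse g) x′))  ≡⟨ cong (λ y → lookup g (lookup s (lookup (inverse g) y))) gx≡x′ ⟨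
      lookup g (lookup s (lookup (inverse g) (lookup g x))) ≡⟨ cong (lookup g ∘ lookup s) (inverse-lookupˡ g∈G x) ⟩
      lookup g (lookup s x)                        ≡⟨ cong (lookup g) sx≡x ⟩
      lookup g x                                   ≡⟨ gx≡x′ ⟩
      x′                                           ∎)
    where open ≡-Reasoning

  stabSize-≤ : ∀ {g x x′} → g ∈ elems G → lookup g x ≡ x′ → stabSize (elems G) x ≤ stabSize (elems G) x′
  stabSize-≤ {g} {x} {x′} g∈G gx≡x′ = begin
    stabSize (elems G) x                                  ≡⟨ length-map (conjugate g) (stabilizer (elems G) x) ⟨
    length (map (conjugate g) (stabilizer (elems G) x))   ≤⟨ unique-⊆⇒length≤ _≟ₚ_ conj! conj⊆ ⟩
    stabSize (elems G) x′                                 ∎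
    where
    open ≤-Reasoning
    conj! : Unique (map (conjugate g) (stabilizer (elems G) x))
    conj! = Unique.map⁺ (conjugate-injective g∈G) (stabilizer-unique x (unique G))
    conj⊆ : map (conjugate g) (stabilizer (elems G) x) ⊆ stabilizer (elems G) x′
    conj⊆ c∈ with _ , s∈Gₓ , refl ← ∈-map⁻ (conjugate g) c∈ = conjugate-stabilizer g∈G gx≡x′ s∈Gₓ

  stabSize-transitive : Transitive (elems G) → ∀ x x′ → stabSize (elems G) x ≡ stabSize (elems G) x′
  stabSize-transitive trans-G x x′
    with _ , g∈G , gx≡x′ ← trans-G x x′ | _ , g′∈G , g′x′≡x ← trans-G x′ x =
    ≤-antisym (stabSize-≤ g∈G gx≡x′) (stabSize-≤ g′∈G g′x′≡x)

filter-intersecting : ∀ {m} {K I : List (Perm m)} {P : Pred (Perm m) 0ℓ} (P? : Decidable P) →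
  Intersecting K I → Intersecting K (filter P? I)
filter-intersecting {I = I} P? (I! , I⊆K , I-int) =
  Unique.filter⁺ P? I! , All.filter⁺ P? I⊆K , λ g∈ h∈ → I-int (sub g∈) (sub h∈)
  where
  sub : filter P? I ⊆ I
  sub = proj₁ ∘ ∈-filter⁻ P? {xs = I}

intersecting-length≤ : ∀ {m} {K I : List (Perm m)} → Intersecting K I → length I ≤ length K
intersecting-length≤ (I! , I⊆K , _) = unique-⊆⇒length≤ _≟ₚ_ I! (All.lookup I⊆K)

-- Constructively we can only keep enlarging an intersecting set while a larger one exists.
¬¬-∃-isMaxIntersecting : ∀ {m} (K : List (Perm m)) → ¬ ¬ ∃ (IsMaxIntersecting K)
¬¬-∃-isMaxIntersecting K = grow (length K) [] ([] , [] , λ ()) ≤-refl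
  where
  grow : ∀ d I → Intersecting K I → length K ≤ length I + d → ¬ ¬ ∃ (IsMaxIntersecting K)
  grow zero I I-int K≤I ¬max = ¬max (length I , (I , I-int , refl) ,
    λ J J-int → ≤-trans (intersecting-length≤ J-int) (≤-trans K≤I (≤-reflexive (+-identityʳ _))))
  grow (suc d) I I-int K≤I ¬max = ¬¬-excluded-middle {A = ∃ λ J → Intersecting K J × length I < length J} λ where
    (yes (J , J-int , I<J)) → grow d J J-int (≤-trans K≤I (≤-trans (≤-reflexive (+-suc _ d)) (+-monoˡ-≤ d I<J))) ¬max
    (no ∄larger) → ¬max (length I , (I , I-int , refl) , λ J J-int → ≮⇒≥ λ I<J → ∄larger (J , J-int , I<J))

module WreathCoordinates {m n : ℕ} where

  wreathElem-combine : ∀ (gs : Vec (Perm m) n) h j b →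
    lookup (wreathElem gs h) (combine j b) ≡ combine (lookup h j) (lookup (lookup gs j) b)
  wreathElem-combine gs h j b = trans (lookup∘tabulate _ (combine j b))
    (cong (λ (i , a) → combine (lookup h i) (lookup (lookup gs i) a)) (Fin.remQuot-combine j b))

  wreathElem-agree : ∀ {gs gs′ : Vec (Perm m) n} {h h′ : Perm n} z →
    lookup (wreathElem gs h) z ≡ lookup (wreathElem gs′ h′) z →
    ∃₂ λ j b → lookup h j ≡ lookup h′ j × lookup (lookup gs j) b ≡ lookup (lookup gs′ j) b
  wreathElem-agree {gs} {gs′} {h} {h′} z agree with j , b , refl ← Fin.combine-surjective {n} {m} z =
    j , b , Fin.combine-injective _ _ _ _
      (trans (sym (wreathElem-combine gs h j b)) (trans agree (wreathElem-combine gs′ h′ j b)))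

  top : Fin m → Perm (n * m) → Perm n
  top a₀ w = tabulate λ j → quotient m (lookup w (combine j a₀))

  base : Perm (n * m) → Vec (Perm m) n
  base w = tabulate λ j → tabulate λ b → remainder {n} m (lookup w (combine j b))

  top-wreathElem : ∀ a₀ gs h → top a₀ (wreathElem gs h) ≡ h
  top-wreathElem a₀ gs h = lookup-ext λ j → begin
    lookup (top a₀ (wreathElem gs h)) j                     ≡⟨ lookup∘tabulate _ j ⟩
    quotient m (lookup (wreathElem gs h) (combine j a₀))    ≡⟨ cong (quotient m) (wreathElem-combine gs h j a₀) ⟩
    quotient m (combine (lookup h j) (lookup (lookup gs j) a₀)) ≡⟨ cong proj₁ (Fin.remQuot-combine (lookup h j) _) ⟩
    lookup h j                                              ∎
    where open ≡-Reasoning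

  base-wreathElem : ∀ gs h → base (wreathElem gs h) ≡ gs
  base-wreathElem gs h = lookup-ext λ j → lookup-ext λ b → begin
    lookup (lookup (base (wreathElem gs h)) j) b                    ≡⟨ cong (λ g → lookup g b) (lookup∘tabulate _ j) ⟩
    lookup (tabulate λ b → remainder {n} m (lookup (wreathElem gs h) (combine j b))) b ≡⟨ lookup∘tabulate _ b ⟩
    remainder {n} m (lookup (wreathElem gs h) (combine j b))          ≡⟨ cong (remainder {n} m) (wreathElem-combine gs h j b) ⟩
    remainder {n} m (combine (lookup h j) (lookup (lookup gs j) b))   ≡⟨ cong proj₂ (Fin.remQuot-combine (lookup h j) _) ⟩
    lookup (lookup gs j) b                                            ∎
    where open ≡-Reasoning

  wreathElem-injective : Fin m → ∀ {gs gs′ : Vec (Perm m) n} {h h′ : Perm n} →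
    wreathElem gs h ≡ wreathElem gs′ h′ → gs ≡ gs′ × h ≡ h′
  wreathElem-injective a₀ {gs} {gs′} {h} {h′} eq =
    trans (sym (base-wreathElem gs h)) (trans (cong base eq) (base-wreathElem gs′ h′)) ,
    trans (sym (top-wreathElem a₀ gs h)) (trans (cong (top a₀) eq) (top-wreathElem a₀ gs′ h′))

module WreathProduct {m k} (G : PermGroup m) (H : PermGroup (suc k)) (a₀ : Fin m) where

  open WreathCoordinates {m} {suc k}

  private
    W = wreath G H
    wr : Perm (suc k) → Vec (Perm m) (suc k) → Perm (suc k * m)
    wr h gs = wreathElem gs h

  wreath≡ : W ≡ deduplicate _≟ₚ_ (cartesianProductWith wr (elems H) (tuplesOf λ _ → elems G))
  wreath≡ = cong (deduplicate _≟ₚ_) (trans (concatMap≡cartesianProductWith wr (elems H) (tuples _ (elems G)))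
                                           (cong (cartesianProductWith wr (elems H)) (tuples≡tuplesOf _ (elems G))))

  wreath-unique : Unique W
  wreath-unique = deduplicate-! _≟ₚ_ _

  wreathElem-∈ : ∀ {gs : Vec (Perm m) (suc k)} {h} → (∀ j → lookup gs j ∈ elems G) → h ∈ elems H →
    wreathElem gs h ∈ W
  wreathElem-∈ {gs} {h} gs∈ h∈ = subst (wreathElem gs h ∈_) (sym wreath≡)
    (∈-deduplicate⁺ _≟ₚ_ (∈-cartesianProductWith⁺ wr {a = h} {b = gs} h∈ (∈-tuplesOf⁺ gs∈)))

  ∈-wreath⁻ : ∀ {w : Perm (suc k * m)} → w ∈ W →
    ∃₂ λ gs h → (∀ j → lookup gs j ∈ elems G) × h ∈ elems H × w ≡ wreathElem gs h
  ∈-wreath⁻ w∈ with h , gs , h∈ , gs∈ , refl ← ∈-cartesianProductWith⁻ wr (elems H) (tuplesOf λ _ → elems G)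
                                                 (∈-deduplicate⁻ _≟ₚ_ _ (subst (_ ∈_) wreath≡ w∈)) =
    gs , h , ∈-tuplesOf⁻ _ gs∈ , h∈ , refl

  wreath-η : ∀ {w : Perm (suc k * m)} → w ∈ W → w ≡ wreathElem (base w) (top a₀ w)
  wreath-η w∈ with gs , h , _ , _ , refl ← ∈-wreath⁻ w∈ =
    sym (cong₂ wreathElem (base-wreathElem gs h) (top-wreathElem a₀ gs h))

  base-∈ : ∀ {w : Perm (suc k * m)} → w ∈ W → ∀ j → lookup (base w) j ∈ elems G
  base-∈ w∈ j with gs , h , gs∈ , _ , refl ← ∈-wreath⁻ w∈ =
    subst (λ gs → lookup gs j ∈ elems G) (sym (base-wreathElem gs h)) (gs∈ j)

  top-∈ : ∀ {w : Perm (suc k * m)} → w ∈ W → top a₀ w ∈ elems H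
  top-∈ w∈ with gs , h , _ , h∈ , refl ← ∈-wreath⁻ w∈ = subst (_∈ elems H) (sym (top-wreathElem a₀ gs h)) h∈

  lookup-wreath : ∀ {w : Perm (suc k * m)} → w ∈ W → ∀ j b →
    lookup w (combine j b) ≡ combine (lookup (top a₀ w) j) (lookup (lookup (base w) j) b)
  lookup-wreath {w} w∈ j b =
    trans (cong (λ v → lookup v (combine j b)) (wreath-η w∈)) (wreathElem-combine (base w) (top a₀ w) j b)

  wreath-agree : ∀ {w w′ : Perm (suc k * m)} → w ∈ W → w′ ∈ W → ∀ z → lookup w z ≡ lookup w′ z →
    ∃₂ λ j b → lookup (top a₀ w) j ≡ lookup (top a₀ w′) j ×
               lookup (lookup (base w) j) b ≡ lookup (lookup (base w′) j) b
  wreath-agree {w} {w′} w∈ w′∈ z agree = wreathElem-agree {base w} {base w′} {top a₀ w} {top a₀ w′} z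
    (trans (cong (λ v → lookup v z) (sym (wreath-η w∈))) (trans agree (cong (λ v → lookup v z) (wreath-η w′∈))))

  liftAt : Fin (suc k) → List (Perm m) → List (Perm (suc k * m))
  liftAt i Q = cartesianProductWith wr (stabilizer (elems H) i) (tuplesAt i Q (elems G))

  length-liftAt : ∀ i Q → length (liftAt i Q) ≡ stabSize (elems H) i * (length Q * length (elems G) ^ k)
  length-liftAt i Q = trans (length-cartesianProductWith wr (stabilizer (elems H) i) (tuplesAt i Q (elems G)))
                            (cong (stabSize (elems H) i *_) (length-tuplesAt i Q (elems G)))

  liftAt-unique : ∀ {i Q} → Unique Q → Unique (liftAt i Q)
  liftAt-unique {i} {Q} Q! = Unique.cartesianProductWith⁺ wr (Product.swap ∘ wreathElem-injective a₀)
    (stabilizer-unique i (unique H)) (tuplesAt-unique i Q (elems G) Q! (unique G))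

  ∈-liftAt⁺ : ∀ {i Q gs h} → (∀ j → lookup gs j ∈ elems G) → lookup gs i ∈ Q →
    h ∈ stabilizer (elems H) i → wreathElem gs h ∈ liftAt i Q
  ∈-liftAt⁺ {i} {Q} {gs} {h} gs∈G gsᵢ∈Q h∈Hᵢ =
    ∈-cartesianProductWith⁺ wr {a = h} {b = gs} h∈Hᵢ (∈-tuplesAt⁺ i Q (elems G) gs∈G gsᵢ∈Q)

  ∈-liftAt⁻ : ∀ {i Q} → Q ⊆ elems G → ∀ {w} → w ∈ liftAt i Q →
    ∃₂ λ gs h → (∀ j → lookup gs j ∈ elems G) × lookup gs i ∈ Q × h ∈ stabilizer (elems H) i ×
                w ≡ wreathElem gs h
  ∈-liftAt⁻ {i} {Q} Q⊆G w∈
    with h , gs , h∈Hᵢ , gs∈ , refl ← ∈-cartesianProductWith⁻ wr (stabilizer (elems H) i) (tuplesAt i Q (elems G)) w∈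
    with gsᵢ∈Q , gs∈G ← ∈-tuplesAt⁻ i Q (elems G) Q⊆G gs∈ = gs , h , gs∈G , gsᵢ∈Q , h∈Hᵢ , refl

  liftAt-intersecting : ∀ {i Q} → Intersecting (elems G) Q → Intersecting W (liftAt i Q)
  liftAt-intersecting {i} {Q} (Q! , Q⊆G , Q-int) = liftAt-unique Q! , All.tabulate lift⊆W , lift-int
    where
    lift⊆W : liftAt i Q ⊆ W
    lift⊆W w∈ with gs , _ , gs∈G , _ , h∈Hᵢ , refl ← ∈-liftAt⁻ (All.lookup Q⊆G) w∈ =
      wreathElem-∈ {gs} gs∈G (proj₁ (∈-stabilizer⁻ (elems H) h∈Hᵢ))
    lift-int : ∀ {w w′} → w ∈ liftAt i Q → w′ ∈ liftAt i Q → ∃ λ z → lookup w z ≡ lookup w′ z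
    lift-int w∈ w′∈
      with gs , h , _ , gsᵢ∈Q , h∈Hᵢ , refl ← ∈-liftAt⁻ (All.lookup Q⊆G) w∈
         | gs′ , h′ , _ , gs′ᵢ∈Q , h′∈Hᵢ , refl ← ∈-liftAt⁻ (All.lookup Q⊆G) w′∈
      with b , agree ← Q-int gsᵢ∈Q gs′ᵢ∈Q = combine i b , (begin
        lookup (wreathElem gs h) (combine i b)              ≡⟨ wreathElem-combine gs h i b ⟩
        combine (lookup h i) (lookup (lookup gs i) b)       ≡⟨ cong₂ combine (trans (hi≡i h∈Hᵢ) (sym (hi≡i h′∈Hᵢ))) agree ⟩
        combine (lookup h′ i) (lookup (lookup gs′ i) b)     ≡⟨ wreathElem-combine gs′ h′ i b ⟨
        lookup (wreathElem gs′ h′) (combine i b)            ∎)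
      where
      open ≡-Reasoning
      hi≡i : ∀ {h} → h ∈ stabilizer (elems H) i → lookup h i ≡ i
      hi≡i = proj₂ ∘ ∈-stabilizer⁻ (elems H)

  stabSize-wreath : ∀ i a → stabSize W (combine i a) ≡ length (liftAt i (stabilizer (elems G) a))
  stabSize-wreath i a = ≤-antisym
    (unique-⊆⇒length≤ _≟ₚ_ (stabilizer-unique (combine i a) wreath-unique) Wᵢₐ⊆lift)
    (unique-⊆⇒length≤ _≟ₚ_ (liftAt-unique (stabilizer-unique a (unique G))) lift⊆Wᵢₐ)
    where
    Wᵢₐ⊆lift : stabilizer W (combine i a) ⊆ liftAt i (stabilizer (elems G) a)
    Wᵢₐ⊆lift {w} w∈Wᵢₐ with w∈W , wia≡ia ← ∈-stabilizer⁻ W w∈Wᵢₐ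
      with hi≡i , gᵢa≡a ← Fin.combine-injective _ _ i a (trans (sym (lookup-wreath w∈W i a)) wia≡ia) =
      subst (_∈ liftAt i (stabilizer (elems G) a)) (sym (wreath-η w∈W))
        (∈-liftAt⁺ {gs = base w} (base-∈ w∈W) (∈-stabilizer⁺ (base-∈ w∈W i) gᵢa≡a)
                                              (∈-stabilizer⁺ (top-∈ w∈W) hi≡i))
    lift⊆Wᵢₐ : liftAt i (stabilizer (elems G) a) ⊆ stabilizer W (combine i a)
    lift⊆Wᵢₐ w∈ with gs , h , gs∈G , gᵢ∈Gₐ , h∈Hᵢ , refl ← ∈-liftAt⁻ (proj₁ ∘ ∈-stabilizer⁻ (elems G)) w∈
      with h∈H , hi≡i ← ∈-stabilizer⁻ (elems H) h∈Hᵢ =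
      ∈-stabilizer⁺ (wreathElem-∈ {gs} gs∈G h∈H)
        (trans (wreathElem-combine gs h i a) (cong₂ combine hi≡i (proj₂ (∈-stabilizer⁻ (elems G) gᵢ∈Gₐ))))

  base₀ : Perm (suc k * m) → Perm m
  base₀ w = lookup (base w) zero

  -- Elements sharing top and key are determined by base₀, and if two of them agree at a point of
  -- block j then their base₀ agree at the key-translate of that point; so each fibre has ≤ kG elements.
  key : Perm (suc k * m) → Vec (Perm m) k
  key w = tabulate λ j → inverse G (base₀ w) ∘ₚ lookup (base w) (suc j)

  key-∈ : ∀ {w : Perm (suc k * m)} → w ∈ W → key w ∈ tuples k (elems G)
  key-∈ {w} w∈ = ∈-tuples⁺ λ j → subst (_∈ elems G) (sym (lookup∘tabulate _ j))
    (closed G (inverse-∈ G (base-∈ w∈ zero)) (base-∈ w∈ (suc j)))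

  base-via-key : ∀ {w : Perm (suc k * m)} → w ∈ W → ∀ j → lookup (base w) (suc j) ≡ base₀ w ∘ₚ lookup (key w) j
  base-via-key {w} w∈ j = lookup-ext λ b → sym (begin
    lookup (base₀ w ∘ₚ lookup (key w) j) b           ≡⟨ lookup-∘ₚ (base₀ w) (lookup (key w) j) b ⟩
    lookup (base₀ w) (lookup (lookup (key w) j) b)   ≡⟨ cong (λ g → lookup (base₀ w) (lookup g b)) (lookup∘tabulate _ j) ⟩
    lookup (base₀ w) (lookup (g₀⁻¹ ∘ₚ gⱼ) b)         ≡⟨ cong (lookup (base₀ w)) (lookup-∘ₚ g₀⁻¹ gⱼ b) ⟩
    lookup (base₀ w) (lookup g₀⁻¹ (lookup gⱼ b))     ≡⟨ inverse-lookupʳ G (base-∈ w∈ zero) (lookup gⱼ b) ⟩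
    lookup gⱼ b                                      ∎)
    where
    open ≡-Reasoning
    g₀⁻¹ = inverse G (base₀ w)
    gⱼ = lookup (base w) (suc j)

  tops-intersecting : ∀ {I} → Intersecting W I → Intersecting (elems H) (deduplicate _≟ₚ_ (map (top a₀) I))
  tops-intersecting {I} (_ , I⊆W , I-int) = deduplicate-! _≟ₚ_ _ , All.tabulate top∈H , tops-int
    where
    from-I : ∀ {h} → h ∈ deduplicate _≟ₚ_ (map (top a₀) I) → ∃ λ w → w ∈ I × h ≡ top a₀ w
    from-I h∈ = ∈-map⁻ (top a₀) (∈-deduplicate⁻ _≟ₚ_ (map (top a₀) I) h∈)
    top∈H : ∀ {h} → h ∈ deduplicate _≟ₚ_ (map (top a₀) I) → h ∈ elems H
    top∈H h∈ with _ , w∈I , refl ← from-I h∈ = top-∈ (All.lookup I⊆W w∈I)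
    tops-int : ∀ {h h′} → h ∈ deduplicate _≟ₚ_ (map (top a₀) I) → h′ ∈ deduplicate _≟ₚ_ (map (top a₀) I) →
      ∃ λ j → lookup h j ≡ lookup h′ j
    tops-int h∈ h′∈ with _ , w∈I , refl ← from-I h∈ | _ , w′∈I , refl ← from-I h′∈
      with z , agree ← I-int w∈I w′∈I
      with j , _ , agreeᵗ , _ ← wreath-agree (All.lookup I⊆W w∈I) (All.lookup I⊆W w′∈I) z agree = j , agreeᵗ

  sameTopKey-intersecting : ∀ {J p K} → Intersecting W J → (∀ {w} → w ∈ J → top a₀ w ≡ p × key w ≡ K) →
    Intersecting (elems G) (map base₀ J)
  sameTopKey-intersecting {J} {p} {K} (J! , J⊆W , J-int) same =
    map⁺-injectiveOn base₀ base₀-injective J! , All.map⁺ (All.tabulate λ w∈ → base-∈ (w∈W w∈) zero) , base₀-int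
    where
    w∈W : ∀ {w} → w ∈ J → w ∈ W
    w∈W = All.lookup J⊆W
    base-via-K : ∀ {w} → w ∈ J → ∀ j → lookup (base w) (suc j) ≡ base₀ w ∘ₚ lookup K j
    base-via-K {w} w∈ j = trans (base-via-key (w∈W w∈) j) (cong (λ K → base₀ w ∘ₚ lookup K j) (proj₂ (same w∈)))
    base₀-injective : ∀ {w w′} → w ∈ J → w′ ∈ J → base₀ w ≡ base₀ w′ → w ≡ w′
    base₀-injective {w} {w′} w∈ w′∈ eq = begin
      w                                     ≡⟨ wreath-η (w∈W w∈) ⟩
      wreathElem (base w) (top a₀ w)        ≡⟨ cong₂ wreathElem (lookup-ext {xs = base w} {base w′} same-base) same-top ⟩
      wreathElem (base w′) (top a₀ w′)      ≡⟨ wreath-η (w∈W w′∈) ⟨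
      w′                                    ∎
      where
      open ≡-Reasoning
      same-top : top a₀ w ≡ top a₀ w′
      same-top = trans (proj₁ (same w∈)) (sym (proj₁ (same w′∈)))
      same-base : ∀ j → lookup (base w) j ≡ lookup (base w′) j
      same-base zero    = eq
      same-base (suc j) = trans (base-via-K w∈ j) (trans (cong (_∘ₚ lookup K j) eq) (sym (base-via-K w′∈ j)))
    base₀-int : ∀ {g g′} → g ∈ map base₀ J → g′ ∈ map base₀ J → ∃ λ b → lookup g b ≡ lookup g′ b
    base₀-int g∈ g′∈ with w , w∈ , refl ← ∈-map⁻ base₀ g∈ | w′ , w′∈ , refl ← ∈-map⁻ base₀ g′∈
      with z , agree ← J-int w∈ w′∈
      with wreath-agree (w∈W w∈) (w∈W w′∈) z agree
    ... | zero  , b , _ , agreeᵇ = b , agreeᵇ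
    ... | suc j , b , _ , agreeᵇ = lookup (lookup K j) b , (begin
      lookup (base₀ w) (lookup (lookup K j) b)   ≡⟨ lookup-∘ₚ (base₀ w) (lookup K j) b ⟨
      lookup (base₀ w ∘ₚ lookup K j) b           ≡⟨ cong (λ g → lookup g b) (base-via-K w∈ j) ⟨
      lookup (lookup (base w) (suc j)) b         ≡⟨ agreeᵇ ⟩
      lookup (lookup (base w′) (suc j)) b        ≡⟨ cong (λ g → lookup g b) (base-via-K w′∈ j) ⟩
      lookup (base₀ w′ ∘ₚ lookup K j) b          ≡⟨ lookup-∘ₚ (base₀ w′) (lookup K j) b ⟩
      lookup (base₀ w′) (lookup (lookup K j) b)  ∎)
      where open ≡-Reasoning

  wreath-intersecting-length≤ : ∀ {kH kG I} → IsMaxIntersecting (elems H) kH → IsMaxIntersecting (elems G) kG →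
    Intersecting W I → length I ≤ kH * (length (elems G) ^ k * kG)
  wreath-intersecting-length≤ {kH} {kG} {I} (_ , H-max) (_ , G-max) I-int@(_ , I⊆W , _) = begin
    length I             ≤⟨ length≤fibres _≟ₚ_ (top a₀) tops I (∈-deduplicate⁺ _≟ₚ_ ∘ ∈-map⁺ (top a₀)) topFibre≤ ⟩
    length tops * bound  ≤⟨ *-monoˡ-≤ bound (H-max tops (tops-intersecting I-int)) ⟩
    kH * bound           ∎
    where
    open ≤-Reasoning
    bound = length (elems G) ^ k * kG
    tops = deduplicate _≟ₚ_ (map (top a₀) I)
    _≟ₖ_ : DecidableEquality (Vec (Perm m) k)
    _≟ₖ_ = ≡-dec _≟ₚ_
    topFibre≤ : ∀ p → length (fibre _≟ₚ_ (top a₀) I p) ≤ bound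
    topFibre≤ p = begin
      length T                          ≤⟨ length≤fibres _≟ₖ_ key (tuples k (elems G)) T (key-∈ ∘ All.lookup I⊆W ∘ T⊆I) keyFibre≤ ⟩
      length (tuples k (elems G)) * kG  ≡⟨ cong (_* kG) (length-tuples k (elems G)) ⟩
      bound                             ∎
      where
      T = fibre _≟ₚ_ (top a₀) I p
      T⊆I : T ⊆ I
      T⊆I = proj₁ ∘ ∈-filter⁻ (λ w → top a₀ w ≟ₚ p) {xs = I}
      keyFibre≤ : ∀ K → length (fibre _≟ₖ_ key T K) ≤ kG
      keyFibre≤ K = begin
        length J              ≡⟨ length-map base₀ J ⟨
        length (map base₀ J)  ≤⟨ G-max (map base₀ J) (sameTopKey-intersecting J-int same) ⟩
        kG                    ∎
        where
        J = fibre _≟ₖ_ key T K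
        J-int : Intersecting W J
        J-int = filter-intersecting _ (filter-intersecting _ I-int)
        same : ∀ {w} → w ∈ J → top a₀ w ≡ p × key w ≡ K
        same w∈J with w∈T , key≡K ← ∈-filter⁻ (λ w → key w ≟ₖ K) {xs = T} w∈J =
          proj₂ (∈-filter⁻ (λ w → top a₀ w ≟ₚ p) {xs = I} w∈T) , key≡K

  wreath-maxIntersecting : ∀ {kH kG kW} i → Transitive (elems H) → EKR (elems H) →
    IsMaxIntersecting (elems H) kH → IsMaxIntersecting (elems G) kG → IsMaxIntersecting W kW →
    kW ≡ stabSize (elems H) i * (kG * length (elems G) ^ k)
  wreath-maxIntersecting {kH} {kG} {kW} i trans-H ekr-H H-max
                         G-max@((IG , IG-int , ∣IG∣≡kG) , _) ((IW , IW-int , ∣IW∣≡kW) , W-max)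
    with j , ∣Hⱼ∣≡kH ← proj₂ (ekr-H kH H-max) = ≤-antisym upper lower
    where
    open ≤-Reasoning
    ∣Hᵢ∣ = stabSize (elems H) i
    T = length (elems G) ^ k
    upper : kW ≤ ∣Hᵢ∣ * (kG * T)
    upper = begin
      kW                 ≡⟨ ∣IW∣≡kW ⟨
      length IW          ≤⟨ wreath-intersecting-length≤ H-max G-max IW-int ⟩
      kH * (T * kG)      ≡⟨ cong₂ _*_ (trans (sym ∣Hⱼ∣≡kH) (stabSize-transitive H trans-H j i)) (*-comm T kG) ⟩
      ∣Hᵢ∣ * (kG * T)    ∎
    lower : ∣Hᵢ∣ * (kG * T) ≤ kW
    lower = begin
      ∣Hᵢ∣ * (kG * T)         ≡⟨ cong (λ n → ∣Hᵢ∣ * (n * T)) ∣IG∣≡kG ⟨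
      ∣Hᵢ∣ * (length IG * T)  ≡⟨ length-liftAt i IG ⟨
      length (liftAt i IG)    ≤⟨ W-max (liftAt i IG) (liftAt-intersecting IG-int) ⟩
      kW                      ∎

corollary4p5 : ∀ {m n} (G : PermGroup m) (H : PermGroup n) →
    Transitive (elems G) → Transitive (elems H) → EKR (elems H) →
    ∀ (kG kW : ℕ) → IsMaxIntersecting (elems G) kG →
    IsMaxIntersecting (wreath G H) kW →
    ∀ (x : Fin m) (y : Fin (n * m)) →
    kW * stabSize (elems G) x ≡ kG * stabSize (wreath G H) y
corollary4p5 {m} {zero}  G H _ _ _ _ _ _ _ _ ()
corollary4p5 {m} {suc k} G H trans-G trans-H ekr-H kG kW G-max W-max x y
  with i , a , refl ← Fin.combine-surjective {suc k} {m} y =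
  decidable-stable (_ ≟ _) λ ≢ → ¬¬-∃-isMaxIntersecting (elems H) λ (kH , H-max) → ≢ (begin
    kW * ∣Gₓ∣                        ≡⟨ cong₂ _*_ (wreath-maxIntersecting i trans-H ekr-H H-max G-max W-max)
                                                  (stabSize-transitive G trans-G x a) ⟩
    ∣Hᵢ∣ * (kG * T) * ∣Gₐ∣           ≡⟨ rearrange ∣Hᵢ∣ kG T ∣Gₐ∣ ⟩
    kG * (∣Hᵢ∣ * (∣Gₐ∣ * T))         ≡⟨ cong (kG *_) (length-liftAt i (stabilizer (elems G) a)) ⟨
    kG * length (liftAt i (stabilizer (elems G) a)) ≡⟨ cong (kG *_) (stabSize-wreath i a) ⟨
    kG * stabSize (wreath G H) (combine i a)        ∎)
  where
  open WreathProduct G H a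
  open ≡-Reasoning
  ∣Gₓ∣ = stabSize (elems G) x
  ∣Gₐ∣ = stabSize (elems G) a
  ∣Hᵢ∣ = stabSize (elems H) i
  T = length (elems G) ^ k
  rearrange : ∀ s c t g → s * (c * t) * g ≡ c * (s * (g * t))
  rearrange = solve-∀
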